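{- Let $G$ be a finite, simple, connected graph with a perfect matching $M$. Let $P=u_{0}u_{1}\ldots u_{2p-1}$ be a longest closed $M$-alternating path in $G$ (so $u_{2i}u_{2i+1}\in M$ for $0\le i\le p-1$). Let $v$, $w$ be the two endvertices of a closed $M$-alternating path in $G-P$. Then for every $1\leq i\leq p-1$: if $G$ is bipartite then $e(\{u_{2i-1},u_{2i}\},\{v,w\})\leq 1$, and otherwise $e(\{u_{2i-1},u_{2i}\},\{v,w\})\leq 2$.
   Context: For disjoint vertex sets $X,Y$, $e(X,Y)$ denotes the number of edges of $G$ with one end in $X$ and the other in $Y$. A perfect matching $M$ is a set of pairwise non-adjacent edges covering every vertex. An $M$-alternating path is a path whose edges lie alternately in $M$ and in $E(G)\setminus M$. A closed $M$-alternating path is either a single edge of $M$ or an $M$-alternating path whose first and last edges belong to $M$. $G-P$ denotes the graph obtained by deleting the vertices of $P$. -}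

module Defs where

open import Data.Nat using (ℕ; _≤_)
open import Data.Fin using (Fin)
open import Data.Bool using (Bool)
open import Data.Product using (_×_; _,_; ∃; proj₁; proj₂)
open import Data.List using (List; []; _∷_; _++_; _∷ʳ_; length; filter; cartesianProduct; concatMap)
open import Data.List.Relation.Unary.All using (All)
open import Data.List.Relation.Unary.Linked using (Linked)
open import Data.List.Relation.Unary.Unique.Propositional using (Unique)
open import Data.List.Membership.Propositional using (_∈_)
open import Relation.Nullary using (¬_; Dec)
open import Relation.Binary.PropositionalEquality using (_≡_; _≢_)
open import Relation.Binary.Construct.Closure.ReflexiveTransitive using (Star)

record SimpleGraph (n : ℕ) : Set₁ where
  field
    Adj    : Fin n → Fin n → Set
    adj?   : (x y : Fin n) → Dec (Adj x y)
    sym    : ∀ {x y} → Adj x y → Adj y x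
    irrefl : ∀ {x} → ¬ Adj x x

open SimpleGraph public

module _ {n : ℕ} (G : SimpleGraph n) where

  Connected : Set
  Connected = (x y : Fin n) → Star (Adj G) x y

  Bipartite : Set
  Bipartite = ∃ λ (c : Fin n → Bool) → ∀ {x y} → Adj G x y → c x ≢ c y

  -- A perfect matching, given by the mate function: every vertex x is covered
  -- by exactly one matching edge, namely x (mate x).
  record PerfectMatching : Set where
    field
      mate      : Fin n → Fin n
      mate-adj  : ∀ x → Adj G x (mate x)
      mate-invol : ∀ x → mate (mate x) ≡ x

  open PerfectMatching public

  -- e(X,Y) for (disjoint) vertex lists X, Y without repetitions.
  e : List (Fin n) → List (Fin n) → ℕ
  e X Y = length (filter (λ p → adj? G (proj₁ p) (proj₂ p)) (cartesianProduct X Y))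

  -- A closed M-alternating path u0 u1 ... u_{2p-1} (p ≥ 1) is represented by the
  -- list of its matching edges (u0,u1) ∷ (u2,u3) ∷ ... ∷ (u_{2p-2},u_{2p-1}).
  vertices : List (Fin n × Fin n) → List (Fin n)
  vertices = concatMap (λ p → proj₁ p ∷ proj₂ p ∷ [])

  module _ (M : PerfectMatching) where

    record ClosedAltPath (ps : List (Fin n × Fin n)) : Set where
      field
        nonempty  : ps ≢ []
        inM       : All (λ p → mate M (proj₁ p) ≡ proj₂ p) ps
        linksNotM : Linked (λ p q → Adj G (proj₂ p) (proj₁ q) × mate M (proj₂ p) ≢ proj₁ q) ps
        distinct  : Unique (vertices ps)

    LongestClosedAltPath : List (Fin n × Fin n) → Set
    LongestClosedAltPath ps = ClosedAltPath ps ×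
      (∀ qs → ClosedAltPath qs → length qs ≤ length ps)

  Endvertices : List (Fin n × Fin n) → Fin n → Fin n → Set
  Endvertices ps v w = ∃ λ mid → vertices ps ≡ (v ∷ mid) ∷ʳ w

  DisjointFrom : List (Fin n × Fin n) → List (Fin n × Fin n) → Set
  DisjointFrom qs ps = ∀ {x} → x ∈ vertices qs → ¬ (x ∈ vertices ps)

module Submission where

-- Lemma 1.4.  Write P = xs ++ (a , b) ∷ (c , d) ∷ ys, so that b c is the
-- non-matching edge u_{2i-1} u_{2i} of P, and let Q run from v to w.
--
-- No detour: if b ~ v and w ~ c, then inserting Q between the consecutive matching
-- edges a b and c d of P gives a closed M-alternating path.  The two new edges are
-- not in M, because the vertex sets of P and Q are closed under taking mates and
-- are disjoint; and the new path is longer than P, contradicting maximality.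
-- Applied to Q and to its reversal, this forbids both "crossing pairs" of edges
-- {bv, cw} and {bw, cv}, so e({b,c},{v,w}) ≤ 2.
--
-- Bipartite case: Q has an odd number of edges, so v and w get different colours,
-- as do the adjacent b and c.  Hence one crossing pair joins equally coloured
-- vertices and is absent, while the other contributes at most one edge: e ≤ 1.

open import Defs
open import Data.Bool using (Bool)
import Data.Bool as Bool
open import Data.Bool.Properties using (¬-not)
open import Data.Empty using (⊥; ⊥-elim)
open import Data.Fin using (Fin)
open import Data.List using (List; []; _∷_; _++_; _∷ʳ_; length; filter; map; InitLast; initLast; _∷ʳ′_)
open import Data.List.Membership.Propositional using (_∈_; _∉_)
open import Data.List.Membership.Propositional.Properties using (∈-++⁺ʳ)
open import Data.List.Properties using (++-assoc; ++-conicalʳ; ∷ʳ-++; concatMap-++; length-++-≤ʳ; ∷-injectiveˡ; ∷ʳ-injectiveʳ)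
open import Data.List.Relation.Binary.Permutation.Propositional using (_↭_; ↭-refl; ↭-sym; ↭-trans; prep; swap; ↭⇒↭ₛ)
open import Data.List.Relation.Binary.Permutation.Propositional.Properties using (shifts; ++-comm; ∈-resp-↭)
import Data.List.Relation.Binary.Permutation.Setoid.Properties as PermSetoid
open import Data.List.Relation.Unary.All using (All; []; _∷_)
import Data.List.Relation.Unary.All as All
import Data.List.Relation.Unary.All.Properties as All
open import Data.List.Relation.Unary.Any using (here; there)
open import Data.List.Relation.Unary.Linked using (Linked; []; [-]; _∷_)
open import Data.List.Relation.Unary.Unique.Propositional using (Unique)
import Data.List.Relation.Unary.Unique.Propositional.Properties as Unique
open import Data.Nat using (ℕ; suc; _≤_; _<_; _+_; z≤n; s≤s)
open import Data.Nat.ListAction using (sum)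
open import Data.Nat.Properties using (≤-refl; <⇒≱; +-mono-≤)
open import Data.Nat.Tactic.RingSolver using (solve-∀)
open import Data.Product using (_×_; _,_; ∃₂; proj₁; proj₂) renaming (swap to flip-pair)
open import Data.Sum using (_⊎_; inj₁; inj₂)
open import Function using (_∘_)
open import Relation.Nullary using (¬_; Dec; yes; no)
open import Relation.Binary.PropositionalEquality
  using (_≡_; _≢_; refl; trans; cong; subst; setoid; module ≡-Reasoning) renaming (sym to ≡-sym)

module _ {A : Set} where

  Linked-split : ∀ {R : A → A → Set} xs {x y ys} → Linked R (xs ++ x ∷ y ∷ ys) →
                 Linked R (xs ∷ʳ x) × R x y × Linked R (y ∷ ys)
  Linked-split []           (r ∷ l) = [-] , r , l
  Linked-split (z ∷ [])     (r ∷ l) with Linked-split [] l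
  ... | _ , r′ , l′ = r ∷ [-] , r′ , l′
  Linked-split (z ∷ z′ ∷ zs) (r ∷ l) with Linked-split (z′ ∷ zs) l
  ... | init , r′ , l′ = r ∷ init , r′ , l′

  Linked-join : ∀ {R : A → A → Set} xs {x y ys} →
                Linked R (xs ∷ʳ x) → R x y → Linked R (y ∷ ys) → Linked R (xs ++ x ∷ y ∷ ys)
  Linked-join []            _          r l = r ∷ l
  Linked-join (z ∷ [])      (r ∷ [-])  r′ l = r ∷ Linked-join [] [-] r′ l
  Linked-join (z ∷ z′ ∷ zs) (r ∷ init) r′ l = r ∷ Linked-join (z′ ∷ zs) init r′ l

  Unique-insert : ∀ (xs ys zs : List A) → Unique (xs ++ zs) → Unique ys →
                  (∀ {u} → u ∈ ys → u ∉ xs ++ zs) → Unique (xs ++ ys ++ zs)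
  Unique-insert xs ys zs xzs! ys! disjoint =
    PermSetoid.Unique-resp-↭ (setoid A) (↭⇒↭ₛ (↭-sym (shifts xs ys)))
      (Unique.++⁺ ys! xzs! (λ (i , j) → disjoint i j))

  inner≢[] : ∀ xs {y : A} {ys} → xs ++ y ∷ ys ≢ []
  inner≢[] []      ()
  inner≢[] (_ ∷ _) ()

  insert-longer : ∀ xs (y : A) ys zs → ys ≢ [] →
                  length (xs ++ y ∷ zs) < length (xs ++ y ∷ ys ++ zs)
  insert-longer []       y []       zs ys≢[] = ⊥-elim (ys≢[] refl)
  insert-longer []       y (_ ∷ ys) zs _     = s≤s (s≤s (length-++-≤ʳ zs {ys}))
  insert-longer (x ∷ xs) y ys       zs ys≢[] = s≤s (insert-longer xs y ys zs ys≢[])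

both-differ : ∀ {x y z : Bool} → x ≢ z → y ≢ z → x ≡ y
both-differ x≢z y≢z = trans (¬-not x≢z) (≡-sym (¬-not y≢z))

indicator : {P : Set} → Dec P → ℕ
indicator (yes _) = 1
indicator (no _)  = 0

length-filter : ∀ {A : Set} {P : A → Set} (P? : ∀ x → Dec (P x)) xs →
                length (filter P? xs) ≡ sum (map (λ x → indicator (P? x)) xs)
length-filter P? []       = refl
length-filter P? (x ∷ xs) with P? x
... | yes _ = cong suc (length-filter P? xs)
... | no _  = length-filter P? xs

exclusive : ∀ {P Q : Set} (p : Dec P) (q : Dec Q) → (P → Q → ⊥) → indicator p + indicator q ≤ 1
exclusive (yes p) (yes q) p⇒¬q = ⊥-elim (p⇒¬q p q)
exclusive (yes _) (no _)  _    = ≤-refl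
exclusive (no _)  (yes _) _    = ≤-refl
exclusive (no _)  (no _)  _    = z≤n

absent : ∀ {P Q : Set} (p : Dec P) (q : Dec Q) → ¬ P → ¬ Q → indicator p + indicator q ≤ 0
absent (yes p) _       ¬p _  = ⊥-elim (¬p p)
absent (no _)  (yes q) _  ¬q = ⊥-elim (¬q q)
absent (no _)  (no _)  _  _  = z≤n

module _ {n : ℕ} (G : SimpleGraph n) (b c v w : Fin n) where

  #bv #bw #cv #cw : ℕ
  #bv = indicator (adj? G b v)
  #bw = indicator (adj? G b w)
  #cv = indicator (adj? G c v)
  #cw = indicator (adj? G c w)

  e-crossing-pairs : e G (b ∷ c ∷ []) (v ∷ w ∷ []) ≡ (#bv + #cw) + (#bw + #cv)
  e-crossing-pairs = begin
    e G (b ∷ c ∷ []) (v ∷ w ∷ [])    ≡⟨ length-filter adjacent ((b , v) ∷ (b , w) ∷ (c , v) ∷ (c , w) ∷ []) ⟩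
    #bv + (#bw + (#cv + (#cw + 0)))  ≡⟨ regroup #bv #bw #cv #cw ⟩
    (#bv + #cw) + (#bw + #cv)        ∎
    where
      open ≡-Reasoning
      adjacent : (p : Fin n × Fin n) → Dec (Adj G (proj₁ p) (proj₂ p))
      adjacent p = adj? G (proj₁ p) (proj₂ p)
      regroup : ∀ i j k l → i + (j + (k + (l + 0))) ≡ (i + l) + (j + k)
      regroup = solve-∀

  e-bound : ∀ {k l} → #bv + #cw ≤ k → #bw + #cv ≤ l → e G (b ∷ c ∷ []) (v ∷ w ∷ []) ≤ k + l
  e-bound bvcw≤k bwcv≤l = subst (_≤ _) (≡-sym e-crossing-pairs) (+-mono-≤ bvcw≤k bwcv≤l)

module Paths {n : ℕ} (G : SimpleGraph n) (M : PerfectMatching G) where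

  Edge : Set
  Edge = Fin n × Fin n

  Matched : Edge → Set
  Matched p = mate M (proj₁ p) ≡ proj₂ p

  Link : Edge → Edge → Set
  Link p q = Adj G (proj₂ p) (proj₁ q) × mate M (proj₂ p) ≢ proj₁ q

  V : List Edge → List (Fin n)
  V = vertices G

  V-++ : ∀ xs ys → V (xs ++ ys) ≡ V xs ++ V ys
  V-++ = concatMap-++ _

  mate-sym : ∀ {x y} → mate M x ≡ y → mate M y ≡ x
  mate-sym {x} refl = mate-invol M x

  matched-adj : ∀ {p} → Matched p → Adj G (proj₁ p) (proj₂ p)
  matched-adj {p} m = subst (Adj G (proj₁ p)) m (mate-adj M (proj₁ p))

  ends-∈ : ∀ {p ps} → p ∈ ps → proj₁ p ∈ V ps × proj₂ p ∈ V ps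
  ends-∈ (here refl) = here refl , there (here refl)
  ends-∈ (there i) with ends-∈ i
  ... | i₁ , i₂ = there (there i₁) , there (there i₂)

  mate-closed : ∀ {ps z} → All Matched ps → z ∈ V ps → mate M z ∈ V ps
  mate-closed (m ∷ _)  (here refl)         = there (here m)
  mate-closed (m ∷ _)  (there (here refl)) = here (mate-sym m)
  mate-closed (_ ∷ ms) (there (there i))   = there (there (mate-closed ms i))

  exit-not-matched : ∀ {ps s t} → All Matched ps → s ∈ V ps → t ∉ V ps → mate M s ≢ t
  exit-not-matched ms s∈ t∉ mate≡t = t∉ (subst (_∈ _) mate≡t (mate-closed ms s∈))

  record Ends (Q : List Edge) (v w : Fin n) : Set where
    field
      y x   : Fin n
      Q₁ Q₂ : List Edge
      first : Q ≡ (v , y) ∷ Q₁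
      final : Q ≡ Q₂ ∷ʳ (x , w)

    first-∈ : (v , y) ∈ Q
    first-∈ = subst ((v , y) ∈_) (≡-sym first) (here refl)

    final-∈ : (x , w) ∈ Q
    final-∈ = subst ((x , w) ∈_) (≡-sym final) (∈-++⁺ʳ Q₂ (here refl))

  open Ends

  starts-at : ∀ Q {v L} → Q ≢ [] → V Q ≡ v ∷ L → ∃₂ λ y Q₁ → Q ≡ (v , y) ∷ Q₁
  starts-at []             Q≢[] _  = ⊥-elim (Q≢[] refl)
  starts-at ((_ , y) ∷ Q₁) _    V≡ = y , Q₁ , cong (λ u → (u , y) ∷ Q₁) (∷-injectiveˡ V≡)

  stops-at : ∀ Q {L w} → InitLast Q → Q ≢ [] → V Q ≡ L ∷ʳ w → ∃₂ λ Q₂ x → Q ≡ Q₂ ∷ʳ (x , w)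
  stops-at .[]             []                Q≢[] _  = ⊥-elim (Q≢[] refl)
  stops-at .(Q₂ ∷ʳ (x , u)) {L} (Q₂ ∷ʳ′ (x , u)) _ V≡ =
    Q₂ , x , cong (λ z → Q₂ ∷ʳ (x , z)) (∷ʳ-injectiveʳ (V Q₂ ∷ʳ x) L
      (trans (++-assoc (V Q₂) (x ∷ []) (u ∷ [])) (trans (≡-sym (V-++ Q₂ ((x , u) ∷ []))) V≡)))

  endvertices⇒Ends : ∀ {Q v w} → Q ≢ [] → Endvertices G Q v w → Ends Q v w
  endvertices⇒Ends {Q} {v} Q≢[] (mid , V≡) =
    let (y , Q₁ , first) = starts-at Q Q≢[] V≡
        (Q₂ , x , final) = stops-at Q {v ∷ mid} (initLast Q) Q≢[] V≡
    in record { y = y ; x = x ; Q₁ = Q₁ ; Q₂ = Q₂ ; first = first ; final = final }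

  reversePath : List Edge → List Edge
  reversePath []       = []
  reversePath (p ∷ ps) = reversePath ps ∷ʳ flip-pair p

  reversePath-∷ʳ : ∀ ps p → reversePath (ps ∷ʳ p) ≡ flip-pair p ∷ reversePath ps
  reversePath-∷ʳ []       p = refl
  reversePath-∷ʳ (q ∷ ps) p = cong (_∷ʳ flip-pair q) (reversePath-∷ʳ ps p)

  reversePath-V : ∀ ps → V (reversePath ps) ↭ V ps
  reversePath-V []            = ↭-refl
  reversePath-V ((x , y) ∷ ps) =
    subst (_↭ (x ∷ y ∷ V ps)) (≡-sym (V-++ (reversePath ps) ((y , x) ∷ [])))
      (↭-trans (++-comm (V (reversePath ps)) (y ∷ x ∷ []))
        (↭-trans (swap y x ↭-refl) (prep x (prep y (reversePath-V ps)))))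

  reversePath-Matched : ∀ {ps} → All Matched ps → All Matched (reversePath ps)
  reversePath-Matched []       = []
  reversePath-Matched (m ∷ ms) = All.++⁺ (reversePath-Matched ms) (mate-sym m ∷ [])

  reversePath-Linked : ∀ {ps} → Linked Link ps → Linked Link (reversePath ps)
  reversePath-Linked []                             = []
  reversePath-Linked [-]                            = [-]
  reversePath-Linked {p ∷ q ∷ ps} ((pq , p≢q) ∷ links) =
    subst (Linked Link) (≡-sym (∷ʳ-++ (reversePath ps) (flip-pair q) (flip-pair p ∷ [])))
      (Linked-join (reversePath ps) (reversePath-Linked links) (sym G pq , p≢q ∘ mate-sym) [-])

  reversePath-nonempty : ∀ {ps} → ps ≢ [] → reversePath ps ≢ []
  reversePath-nonempty {[]}     ps≢[] _      = ps≢[] refl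
  reversePath-nonempty {p ∷ ps} _     rev≡[] with ++-conicalʳ (reversePath ps) _ rev≡[]
  ... | ()

  reversePath-closed : ∀ {Q} → ClosedAltPath G M Q → ClosedAltPath G M (reversePath Q)
  reversePath-closed {Q} path = record
    { nonempty  = reversePath-nonempty nonempty
    ; inM       = reversePath-Matched inM
    ; linksNotM = reversePath-Linked linksNotM
    ; distinct  = PermSetoid.Unique-resp-↭ (setoid (Fin n)) (↭⇒↭ₛ (↭-sym (reversePath-V Q))) distinct
    }
    where
      open ClosedAltPath path

  reversePath-Ends : ∀ {Q v w} → Ends Q v w → Ends (reversePath Q) w v
  reversePath-Ends ends = record
    { y = x ends ; x = y ends ; Q₁ = reversePath (Q₂ ends) ; Q₂ = reversePath (Q₁ ends)
    ; first = trans (cong reversePath (final ends)) (reversePath-∷ʳ (Q₂ ends) _)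
    ; final = cong reversePath (first ends)
    }

  splice : ∀ xs p q ys {Q v w} (ends : Ends Q v w) →
           ClosedAltPath G M (xs ++ p ∷ q ∷ ys) → ClosedAltPath G M Q →
           DisjointFrom G Q (xs ++ p ∷ q ∷ ys) →
           Link p (v , y ends) → Link (x ends , w) q →
           ClosedAltPath G M (xs ++ p ∷ Q ++ q ∷ ys)
  splice xs p q ys {Q} ends P-path Q-path disjoint link₁ link₂ = record
    { nonempty  = inner≢[] xs
    ; inM       = All.++⁺ xs-matched (p-matched ∷ All.++⁺ Q.inM qys-matched)
    ; linksNotM = subst (Linked Link) (cong (λ Q′ → xs ++ p ∷ Q′ ++ q ∷ ys) (≡-sym (first ends)))
                    (Linked-join xs xsp-links link₁
                      (subst (Linked Link) (cong (_++ q ∷ ys) (first ends)) Q-qys-links))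
    ; distinct  = subst Unique (≡-sym V-spliced)
                    (Unique-insert (V (xs ∷ʳ p)) (V Q) (V (q ∷ ys))
                      (subst Unique V-P P.distinct) Q.distinct
                      (λ u∈Q u∈P → disjoint u∈Q (subst (_ ∈_) (≡-sym V-P) u∈P)))
    }
    where
      module P = ClosedAltPath P-path
      module Q = ClosedAltPath Q-path

      xs-matched : All Matched xs
      xs-matched = All.++⁻ˡ xs P.inM
      p-matched : Matched p
      p-matched = All.head (All.++⁻ʳ xs P.inM)
      qys-matched : All Matched (q ∷ ys)
      qys-matched = All.tail (All.++⁻ʳ xs P.inM)

      xsp-links : Linked Link (xs ∷ʳ p)
      xsp-links = proj₁ (Linked-split xs P.linksNotM)

      Q-qys-links : Linked Link (Q ++ q ∷ ys)
      Q-qys-links =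
        subst (Linked Link) (trans (≡-sym (∷ʳ-++ (Q₂ ends) _ (q ∷ ys))) (cong (_++ q ∷ ys) (≡-sym (final ends))))
          (Linked-join (Q₂ ends) (subst (Linked Link) (final ends) Q.linksNotM) link₂
            (proj₂ (proj₂ (Linked-split xs P.linksNotM))))

      V-P : V (xs ++ p ∷ q ∷ ys) ≡ V (xs ∷ʳ p) ++ V (q ∷ ys)
      V-P = trans (cong V (≡-sym (∷ʳ-++ xs p (q ∷ ys)))) (V-++ (xs ∷ʳ p) (q ∷ ys))

      V-spliced : V (xs ++ p ∷ Q ++ q ∷ ys) ≡ V (xs ∷ʳ p) ++ V Q ++ V (q ∷ ys)
      V-spliced = trans (cong V (≡-sym (∷ʳ-++ xs p (Q ++ q ∷ ys))))
                    (trans (V-++ (xs ∷ʳ p) (Q ++ q ∷ ys)) (cong (V (xs ∷ʳ p) ++_) (V-++ Q (q ∷ ys))))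

  no-detour : ∀ xs ys {a b c d Q v w} → LongestClosedAltPath G M (xs ++ (a , b) ∷ (c , d) ∷ ys) →
              ClosedAltPath G M Q → DisjointFrom G Q (xs ++ (a , b) ∷ (c , d) ∷ ys) →
              Ends Q v w → Adj G b v → Adj G w c → ⊥
  no-detour xs ys {a} {b} {c} {d} {Q} {v} {w} (P-path , longest) Q-path disjoint ends bv wc =
    <⇒≱ (insert-longer xs (a , b) Q ((c , d) ∷ ys) (ClosedAltPath.nonempty Q-path))
      (longest _ (splice xs (a , b) (c , d) ys ends P-path Q-path disjoint link₁ link₂))
    where
      b∈P : b ∈ V (xs ++ (a , b) ∷ (c , d) ∷ ys)
      b∈P = proj₂ (ends-∈ (∈-++⁺ʳ xs (here refl)))
      c∈P : c ∈ V (xs ++ (a , b) ∷ (c , d) ∷ ys)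
      c∈P = proj₁ (ends-∈ (∈-++⁺ʳ xs (there (here refl))))

      link₁ : Link (a , b) (v , y ends)
      link₁ = bv , exit-not-matched (ClosedAltPath.inM P-path) b∈P (disjoint (proj₁ (ends-∈ (first-∈ ends))))
      link₂ : Link (x ends , w) (c , d)
      link₂ = wc , exit-not-matched (ClosedAltPath.inM Q-path) (proj₂ (ends-∈ (final-∈ ends))) (λ c∈Q → disjoint c∈Q c∈P)

module Colouring {n : ℕ} (G : SimpleGraph n) (M : PerfectMatching G)
                 (col : Fin n → Bool) (proper : ∀ {x y} → Adj G x y → col x ≢ col y) where

  open Paths G M
  open Ends

  same-side : ∀ p ps → All Matched (p ∷ ps) → Linked Link (p ∷ ps) →
              All (λ q → col (proj₁ q) ≡ col (proj₁ p)) (p ∷ ps)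
  same-side p []       _        _             = refl ∷ []
  same-side p (q ∷ qs) (m ∷ ms) (lk ∷ links) =
    refl ∷ All.map (λ q′≡q → trans q′≡q q≡p) (same-side q qs ms links)
    where
      q≡p : col (proj₁ q) ≡ col (proj₁ p)
      q≡p = both-differ (proper (sym G (proj₁ lk))) (proper (matched-adj m))

  ends-differ : ∀ {Q v w} → ClosedAltPath G M Q → Ends Q v w → col v ≢ col w
  ends-differ {v = v} Q-path ends colv≡colw =
    proper (matched-adj (All.lookup inM (final-∈ ends))) (trans x≡v colv≡colw)
    where
      open ClosedAltPath Q-path
      x≡v : col (x ends) ≡ col v
      x≡v = All.lookup (same-side _ (Q₁ ends) (subst (All Matched) (first ends) inM)
                                            (subst (Linked Link) (first ends) linksNotM))
                       (subst (_ ∈_) (first ends) (final-∈ ends))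

  crossing-pair-absent : ∀ {b c v w} → col b ≢ col c → col v ≢ col w →
                         (¬ Adj G b v × ¬ Adj G c w) ⊎ (¬ Adj G b w × ¬ Adj G c v)
  crossing-pair-absent {b} {c} {v} {w} b≢c v≢w with col b Bool.≟ col v
  ... | yes b≡v = inj₁ ( (λ bv → proper bv b≡v)
                       , (λ cw → proper cw (both-differ (b≢c ∘ ≡-sym) (subst (col w ≢_) (≡-sym b≡v) (v≢w ∘ ≡-sym)))))
  ... | no b≢v  = inj₂ ( (λ bw → proper bw (both-differ b≢v (v≢w ∘ ≡-sym)))
                       , (λ cv → proper cv (both-differ (b≢c ∘ ≡-sym) (b≢v ∘ ≡-sym))))

lemma1p4 : ∀ {n : ℕ} (G : SimpleGraph n) → Connected G → (M : PerfectMatching G) →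
    (P : List (Fin n × Fin n)) → LongestClosedAltPath G M P →
    (Q : List (Fin n × Fin n)) → ClosedAltPath G M Q → DisjointFrom G Q P →
    (v w : Fin n) → Endvertices G Q v w →
    (xs ys : List (Fin n × Fin n)) (a b c d : Fin n) →
    P ≡ xs ++ (a , b) ∷ (c , d) ∷ ys →
    (Bipartite G → e G (b ∷ c ∷ []) (v ∷ w ∷ []) ≤ 1) ×
    (¬ Bipartite G → e G (b ∷ c ∷ []) (v ∷ w ∷ []) ≤ 2)
lemma1p4 G _ M _ P-longest Q Q-path disjoint v w endvs xs ys a b c d refl =
  bipartite-bound , λ _ → e-bound G b c v w pair₁-exclusive pair₂-exclusive
  where
    open Paths G M
    ends : Ends Q v w
    ends = endvertices⇒Ends (ClosedAltPath.nonempty Q-path) endvs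

    no-cross₁ : Adj G b v → Adj G c w → ⊥
    no-cross₁ bv cw = no-detour xs ys P-longest Q-path disjoint ends bv (sym G cw)

    no-cross₂ : Adj G b w → Adj G c v → ⊥
    no-cross₂ bw cv = no-detour xs ys P-longest (reversePath-closed Q-path)
      (disjoint ∘ ∈-resp-↭ (reversePath-V Q)) (reversePath-Ends ends) bw (sym G cv)

    pair₁-exclusive : #bv G b c v w + #cw G b c v w ≤ 1
    pair₁-exclusive = exclusive (adj? G b v) (adj? G c w) no-cross₁

    pair₂-exclusive : #bw G b c v w + #cv G b c v w ≤ 1
    pair₂-exclusive = exclusive (adj? G b w) (adj? G c v) no-cross₂

    bc : Adj G b c
    bc = proj₁ (proj₁ (proj₂ (Linked-split xs (ClosedAltPath.linksNotM (proj₁ P-longest)))))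

    bipartite-bound : Bipartite G → e G (b ∷ c ∷ []) (v ∷ w ∷ []) ≤ 1
    bipartite-bound (col , proper) = bound (crossing-pair-absent (proper bc) (ends-differ Q-path ends))
      where
        open Colouring G M col proper
        bound : (¬ Adj G b v × ¬ Adj G c w) ⊎ (¬ Adj G b w × ¬ Adj G c v) → e G (b ∷ c ∷ []) (v ∷ w ∷ []) ≤ 1
        bound (inj₁ (¬bv , ¬cw)) = e-bound G b c v w (absent (adj? G b v) (adj? G c w) ¬bv ¬cw) pair₂-exclusive
        bound (inj₂ (¬bw , ¬cv)) = e-bound G b c v w pair₁-exclusive (absent (adj? G b w) (adj? G c v) ¬bw ¬cv)
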